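{- The reduction relation $\to$ on $\Lambda_R$ has the Church–Rosser property: for all terms $M,M_1,M_2$, if $M\to^*M_1$ and $M\to^*M_2$, then there exists $M_3$ with $M_1\to^*M_3$ and $M_2\to^*M_3$.
   Context: $\Lambda_R$ terms: $M,N::=x\mid\lambda x.M\mid MN\mid M.l\mid R\mid M\oplus R$, where $x$ ranges over variables, $l$ over labels, and records are $R::=\langle l_i=M_i\mid i\in I\rangle$ with $I$ finite and labels pairwise distinct; terms are identified up to renaming of bound variables and $M[N/x]$ denotes capture-avoiding substitution. Reduction $\to$ is the least relation compatible with all term constructors (i.e. closed under reduction inside any subterm) containing: $(\beta)$ $(\lambda x.M)N\to M[N/x]$; (sel) $\langle l_i=M_i\mid i\in I\rangle.l_j\to M_j$ if $j\in I$; ($\oplus$) $\langle l_i=M_i\mid i\in I\rangle\oplus\langle l_j=N_j\mid j\in J\rangle\to\langle l_i=M_i,\,l_j=N_j\mid i\in I\setminus J,\,j\in J\rangle$. $\to^*$ is the reflexive transitive closure of $\to$. -}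

module Defs where

open import Data.Nat using (ℕ; zero; suc; _<_)
open import Data.Nat.Properties using (<-cmp)
open import Data.Maybe using (Maybe; just; nothing)
open import Data.Unit using (⊤)
open import Data.Product using (_×_)
open import Relation.Binary.Definitions using (tri<; tri≈; tri>)
open import Relation.Binary.PropositionalEquality using (_≡_)
open import Relation.Binary.Construct.Closure.ReflexiveTransitive using (Star)

-- Labels are natural numbers (any countable set with decidable order would do).
Label : Set
Label = ℕ

-- Terms of Λ_R, with de Bruijn indices (so terms are identified up to
-- renaming of bound variables).  A record ⟨ l_i = M_i | i ∈ I ⟩ is a finite
-- list of fields; well-formed records (see WF below) have strictly
-- increasing labels, which is the canonical representation of a finite
-- family indexed by pairwise distinct labels.
data Term : Set
data Rec : Set

infixl 6 _⊕_

data Term where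
  var  : ℕ → Term
  lam  : Term → Term
  app  : Term → Term → Term
  sel  : Term → Label → Term
  rec  : Rec → Term
  _⊕_  : Term → Rec → Term

data Rec where
  ε     : Rec
  _≔_,_ : Label → Term → Rec → Rec

ext : (ℕ → ℕ) → ℕ → ℕ
ext ρ zero    = zero
ext ρ (suc n) = suc (ρ n)

rename    : (ℕ → ℕ) → Term → Term
renameRec : (ℕ → ℕ) → Rec → Rec
rename ρ (var x)   = var (ρ x)
rename ρ (lam M)   = lam (rename (ext ρ) M)
rename ρ (app M N) = app (rename ρ M) (rename ρ N)
rename ρ (sel M l) = sel (rename ρ M) l
rename ρ (rec R)   = rec (renameRec ρ R)
rename ρ (M ⊕ R)   = rename ρ M ⊕ renameRec ρ R
renameRec ρ ε           = ε
renameRec ρ (l ≔ M , R) = l ≔ rename ρ M , renameRec ρ R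

exts : (ℕ → Term) → ℕ → Term
exts σ zero    = var zero
exts σ (suc n) = rename suc (σ n)

subst    : (ℕ → Term) → Term → Term
substRec : (ℕ → Term) → Rec → Rec
subst σ (var x)   = σ x
subst σ (lam M)   = lam (subst (exts σ) M)
subst σ (app M N) = app (subst σ M) (subst σ N)
subst σ (sel M l) = sel (subst σ M) l
subst σ (rec R)   = rec (substRec σ R)
subst σ (M ⊕ R)   = subst σ M ⊕ substRec σ R
substRec σ ε           = ε
substRec σ (l ≔ M , R) = l ≔ subst σ M , substRec σ R

single : Term → ℕ → Term
single N zero    = N
single N (suc n) = var n

_[_] : Term → Term → Term
M [ N ] = subst (single N) M

lookup : Rec → Label → Maybe Term
lookup ε l = nothing
lookup (k ≔ M , R) l with <-cmp k l
... | tri< _ _ _ = lookup R l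
... | tri≈ _ _ _ = just M
... | tri> _ _ _ = lookup R l

-- On well-formed records this is exactly
-- ⟨ l_i = M_i , l_j = N_j | i ∈ I \ J , j ∈ J ⟩ (in canonical sorted form).
merge : Rec → Rec → Rec
merge ε S = S
merge (l ≔ M , R) S = go S
  where
  go : Rec → Rec
  go ε = l ≔ M , R
  go (k ≔ N , S') with <-cmp l k
  ... | tri< _ _ _ = l ≔ M , merge R (k ≔ N , S')
  ... | tri≈ _ _ _ = k ≔ N , merge R S'
  ... | tri> _ _ _ = k ≔ N , go S'

HeadAbove : Label → Rec → Set
HeadAbove l ε           = ⊤
HeadAbove l (k ≔ _ , _) = l < k

data WF  : Term → Set
data WFR : Rec → Set

data WF where
  wf-var : ∀ {x} → WF (var x)
  wf-lam : ∀ {M} → WF M → WF (lam M)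
  wf-app : ∀ {M N} → WF M → WF N → WF (app M N)
  wf-sel : ∀ {M l} → WF M → WF (sel M l)
  wf-rec : ∀ {R} → WFR R → WF (rec R)
  wf-⊕   : ∀ {M R} → WF M → WFR R → WF (M ⊕ R)

data WFR where
  wf-ε  : WFR ε
  fld   : ∀ {l M R} → WF M → HeadAbove l R → WFR R → WFR (l ≔ M , R)

infix 4 _⟶_ _⟶ᴿ_ _⟶*_

data _⟶_  : Term → Term → Set
data _⟶ᴿ_ : Rec → Rec → Set

data _⟶_ where
  β     : ∀ {M N} → app (lam M) N ⟶ M [ N ]
  sel   : ∀ {R l M} → lookup R l ≡ just M → sel (rec R) l ⟶ M
  merge⊕ : ∀ {R S} → rec R ⊕ S ⟶ rec (merge R S)
  ξlam  : ∀ {M M'} → M ⟶ M' → lam M ⟶ lam M'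
  ξappˡ : ∀ {M M' N} → M ⟶ M' → app M N ⟶ app M' N
  ξappʳ : ∀ {M N N'} → N ⟶ N' → app M N ⟶ app M N'
  ξsel  : ∀ {M M' l} → M ⟶ M' → sel M l ⟶ sel M' l
  ξrec  : ∀ {R R'} → R ⟶ᴿ R' → rec R ⟶ rec R'
  ξ⊕ˡ   : ∀ {M M' R} → M ⟶ M' → M ⊕ R ⟶ M' ⊕ R
  ξ⊕ʳ   : ∀ {M R R'} → R ⟶ᴿ R' → M ⊕ R ⟶ M ⊕ R'

data _⟶ᴿ_ where
  here  : ∀ {l M M' R} → M ⟶ M' → (l ≔ M , R) ⟶ᴿ (l ≔ M' , R)
  there : ∀ {l M R R'} → R ⟶ᴿ R' → (l ≔ M , R) ⟶ᴿ (l ≔ M , R')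

_⟶*_ : Term → Term → Set
_⟶*_ = Star _⟶_

-- Tait and Martin-Löf's method with Takahashi's complete development.
-- Parallel reduction ⇛ contracts any set of redexes present in a term at
-- once, and ⟶ ⊆ ⇛ ⊆ ⟶*.  Every parallel step out of M can be completed to
-- the development of M, which contracts all redexes of M; this triangle
-- property makes ⇛ confluent, and confluence carries over to ⟶.  The record
-- operations only ever inspect labels, so merging and lookup commute with
-- every fieldwise map (renaming, substitution) and with fieldwise parallel
-- reduction.
module Submission where

open import Defs
open import Data.Maybe using (Maybe; just; nothing)
open import Data.Nat using (ℕ; zero; suc)
open import Data.Nat.Properties using (<-cmp)
open import Data.Product using (Σ; _×_; _,_; ∃)
open import Level using (Level)
open import Relation.Binary.Core using (Rel)
open import Relation.Binary.Definitions using (tri<; tri≈; tri>)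
open import Relation.Binary.PropositionalEquality
  using (_≡_; refl; sym; trans; cong; cong₂) renaming (subst to transport)
open import Relation.Binary.Construct.Closure.ReflexiveTransitive
  using (Star; ε; _◅_; _◅◅_; gmap; return; _⋆)
import Relation.Binary.Construct.Closure.ReflexiveTransitive as Star
open import Relation.Binary.Rewriting using (Confluent)

module _ {a ℓ : Level} {A : Set a} {_⇛_ : Rel A ℓ}
         (develop : A → A) (triangle : ∀ {M N} → M ⇛ N → N ⇛ develop M) where

  strip : ∀ {M N P} → M ⇛ N → Star _⇛_ M P → ∃ λ Q → Star _⇛_ N Q × P ⇛ Q
  strip {N = N} p ε = N , ε , p
  strip p (q ◅ qs) with strip (triangle q) qs
  ... | Q , ns , pq = Q , triangle p ◅ ns , pq

  triangle⇒confluent : Confluent _⇛_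
  triangle⇒confluent {C = C} ε qs = C , qs , ε
  triangle⇒confluent (p ◅ ps) qs with strip p qs
  ... | Q , ns , pq with triangle⇒confluent ps ns
  ...   | D , bs , qd = D , bs , pq ◅ qd

module _ {a ℓ₁ ℓ₂ : Level} {A : Set a} {_⟶_ : Rel A ℓ₁} {_⇛_ : Rel A ℓ₂} where

  sandwich⇒confluent : (∀ {M N} → M ⟶ N → M ⇛ N) → (∀ {M N} → M ⇛ N → Star _⟶_ M N) →
                       Confluent _⇛_ → Confluent _⟶_
  sandwich⇒confluent ⟶⊆⇛ ⇛⊆⟶* conf s t with conf (Star.map ⟶⊆⇛ s) (Star.map ⟶⊆⇛ t)
  ... | D , u , v = D , (⇛⊆⟶* ⋆) u , (⇛⊆⟶* ⋆) v

ext-cong : ∀ {ρ ρ' : ℕ → ℕ} → (∀ x → ρ x ≡ ρ' x) → ∀ x → ext ρ x ≡ ext ρ' x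
ext-cong h zero    = refl
ext-cong h (suc x) = cong suc (h x)

rename-cong    : ∀ {ρ ρ' : ℕ → ℕ} → (∀ x → ρ x ≡ ρ' x) → ∀ M → rename ρ M ≡ rename ρ' M
renameRec-cong : ∀ {ρ ρ' : ℕ → ℕ} → (∀ x → ρ x ≡ ρ' x) → ∀ R → renameRec ρ R ≡ renameRec ρ' R
rename-cong h (var x)   = cong var (h x)
rename-cong h (lam M)   = cong lam (rename-cong (ext-cong h) M)
rename-cong h (app M N) = cong₂ app (rename-cong h M) (rename-cong h N)
rename-cong h (sel M l) = cong (λ X → sel X l) (rename-cong h M)
rename-cong h (rec R)   = cong rec (renameRec-cong h R)
rename-cong h (M ⊕ R)   = cong₂ _⊕_ (rename-cong h M) (renameRec-cong h R)
renameRec-cong h ε           = refl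
renameRec-cong h (l ≔ M , R) = cong₂ (l ≔_,_) (rename-cong h M) (renameRec-cong h R)

exts-cong : ∀ {σ τ : ℕ → Term} → (∀ x → σ x ≡ τ x) → ∀ x → exts σ x ≡ exts τ x
exts-cong h zero    = refl
exts-cong h (suc x) = cong (rename suc) (h x)

subst-cong    : ∀ {σ τ : ℕ → Term} → (∀ x → σ x ≡ τ x) → ∀ M → subst σ M ≡ subst τ M
substRec-cong : ∀ {σ τ : ℕ → Term} → (∀ x → σ x ≡ τ x) → ∀ R → substRec σ R ≡ substRec τ R
subst-cong h (var x)   = h x
subst-cong h (lam M)   = cong lam (subst-cong (exts-cong h) M)
subst-cong h (app M N) = cong₂ app (subst-cong h M) (subst-cong h N)
subst-cong h (sel M l) = cong (λ X → sel X l) (subst-cong h M)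
subst-cong h (rec R)   = cong rec (substRec-cong h R)
subst-cong h (M ⊕ R)   = cong₂ _⊕_ (subst-cong h M) (substRec-cong h R)
substRec-cong h ε           = refl
substRec-cong h (l ≔ M , R) = cong₂ (l ≔_,_) (subst-cong h M) (substRec-cong h R)

rename-rename    : ∀ (ρ ρ' : ℕ → ℕ) M → rename ρ (rename ρ' M) ≡ rename (λ x → ρ (ρ' x)) M
renameRec-rename : ∀ (ρ ρ' : ℕ → ℕ) R → renameRec ρ (renameRec ρ' R) ≡ renameRec (λ x → ρ (ρ' x)) R
rename-rename ρ ρ' (var x)   = refl
rename-rename ρ ρ' (lam M)   =
  cong lam (trans (rename-rename (ext ρ) (ext ρ') M) (rename-cong (λ { zero → refl ; (suc x) → refl }) M))
rename-rename ρ ρ' (app M N) = cong₂ app (rename-rename ρ ρ' M) (rename-rename ρ ρ' N)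
rename-rename ρ ρ' (sel M l) = cong (λ X → sel X l) (rename-rename ρ ρ' M)
rename-rename ρ ρ' (rec R)   = cong rec (renameRec-rename ρ ρ' R)
rename-rename ρ ρ' (M ⊕ R)   = cong₂ _⊕_ (rename-rename ρ ρ' M) (renameRec-rename ρ ρ' R)
renameRec-rename ρ ρ' ε           = refl
renameRec-rename ρ ρ' (l ≔ M , R) = cong₂ (l ≔_,_) (rename-rename ρ ρ' M) (renameRec-rename ρ ρ' R)

rename-subst    : ∀ (ρ : ℕ → ℕ) (σ : ℕ → Term) M →
                  rename ρ (subst σ M) ≡ subst (λ x → rename ρ (σ x)) M
renameRec-subst : ∀ (ρ : ℕ → ℕ) (σ : ℕ → Term) R →
                  renameRec ρ (substRec σ R) ≡ substRec (λ x → rename ρ (σ x)) R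
rename-subst ρ σ (var x)   = refl
rename-subst ρ σ (lam M)   = cong lam (trans (rename-subst (ext ρ) (exts σ) M) (subst-cong exts-ext M))
  where
  exts-ext : ∀ x → rename (ext ρ) (exts σ x) ≡ exts (λ y → rename ρ (σ y)) x
  exts-ext zero    = refl
  exts-ext (suc x) = trans (rename-rename (ext ρ) suc (σ x)) (sym (rename-rename suc ρ (σ x)))
rename-subst ρ σ (app M N) = cong₂ app (rename-subst ρ σ M) (rename-subst ρ σ N)
rename-subst ρ σ (sel M l) = cong (λ X → sel X l) (rename-subst ρ σ M)
rename-subst ρ σ (rec R)   = cong rec (renameRec-subst ρ σ R)
rename-subst ρ σ (M ⊕ R)   = cong₂ _⊕_ (rename-subst ρ σ M) (renameRec-subst ρ σ R)
renameRec-subst ρ σ ε           = refl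
renameRec-subst ρ σ (l ≔ M , R) = cong₂ (l ≔_,_) (rename-subst ρ σ M) (renameRec-subst ρ σ R)

subst-rename    : ∀ (σ : ℕ → Term) (ρ : ℕ → ℕ) M → subst σ (rename ρ M) ≡ subst (λ x → σ (ρ x)) M
substRec-rename : ∀ (σ : ℕ → Term) (ρ : ℕ → ℕ) R →
                  substRec σ (renameRec ρ R) ≡ substRec (λ x → σ (ρ x)) R
subst-rename σ ρ (var x)   = refl
subst-rename σ ρ (lam M)   =
  cong lam (trans (subst-rename (exts σ) (ext ρ) M) (subst-cong (λ { zero → refl ; (suc x) → refl }) M))
subst-rename σ ρ (app M N) = cong₂ app (subst-rename σ ρ M) (subst-rename σ ρ N)
subst-rename σ ρ (sel M l) = cong (λ X → sel X l) (subst-rename σ ρ M)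
subst-rename σ ρ (rec R)   = cong rec (substRec-rename σ ρ R)
subst-rename σ ρ (M ⊕ R)   = cong₂ _⊕_ (subst-rename σ ρ M) (substRec-rename σ ρ R)
substRec-rename σ ρ ε           = refl
substRec-rename σ ρ (l ≔ M , R) = cong₂ (l ≔_,_) (subst-rename σ ρ M) (substRec-rename σ ρ R)

subst-subst    : ∀ (σ τ : ℕ → Term) M → subst σ (subst τ M) ≡ subst (λ x → subst σ (τ x)) M
substRec-subst : ∀ (σ τ : ℕ → Term) R →
                 substRec σ (substRec τ R) ≡ substRec (λ x → subst σ (τ x)) R
subst-subst σ τ (var x)   = refl
subst-subst σ τ (lam M)   = cong lam (trans (subst-subst (exts σ) (exts τ) M) (subst-cong exts-exts M))
  where
  exts-exts : ∀ x → subst (exts σ) (exts τ x) ≡ exts (λ y → subst σ (τ y)) x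
  exts-exts zero    = refl
  exts-exts (suc x) = trans (subst-rename (exts σ) suc (τ x)) (sym (rename-subst suc σ (τ x)))
subst-subst σ τ (app M N) = cong₂ app (subst-subst σ τ M) (subst-subst σ τ N)
subst-subst σ τ (sel M l) = cong (λ X → sel X l) (subst-subst σ τ M)
subst-subst σ τ (rec R)   = cong rec (substRec-subst σ τ R)
subst-subst σ τ (M ⊕ R)   = cong₂ _⊕_ (subst-subst σ τ M) (substRec-subst σ τ R)
substRec-subst σ τ ε           = refl
substRec-subst σ τ (l ≔ M , R) = cong₂ (l ≔_,_) (subst-subst σ τ M) (substRec-subst σ τ R)

subst-var    : ∀ M → subst var M ≡ M
substRec-var : ∀ R → substRec var R ≡ R
subst-var (var x)   = refl
subst-var (lam M)   = cong lam (trans (subst-cong (λ { zero → refl ; (suc x) → refl }) M) (subst-var M))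
subst-var (app M N) = cong₂ app (subst-var M) (subst-var N)
subst-var (sel M l) = cong (λ X → sel X l) (subst-var M)
subst-var (rec R)   = cong rec (substRec-var R)
subst-var (M ⊕ R)   = cong₂ _⊕_ (subst-var M) (substRec-var R)
substRec-var ε           = refl
substRec-var (l ≔ M , R) = cong₂ (l ≔_,_) (subst-var M) (substRec-var R)

rename-[] : ∀ ρ M N → rename ρ (M [ N ]) ≡ rename (ext ρ) M [ rename ρ N ]
rename-[] ρ M N = trans (rename-subst ρ (single N) M)
  (trans (subst-cong (λ { zero → refl ; (suc x) → refl }) M)
         (sym (subst-rename (single (rename ρ N)) (ext ρ) M)))

subst-[] : ∀ σ M N → subst σ (M [ N ]) ≡ subst (exts σ) M [ subst σ N ]
subst-[] σ M N = trans (subst-subst σ (single N) M)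
  (trans (subst-cong single-exts M) (sym (subst-subst (single (subst σ N)) (exts σ) M)))
  where
  single-exts : ∀ x → subst σ (single N x) ≡ subst (single (subst σ N)) (exts σ x)
  single-exts zero    = refl
  single-exts (suc x) = sym (trans (subst-rename (single (subst σ N)) suc (σ x)) (subst-var (σ x)))

data Pointwise (P : Term → Term → Set) : Rec → Rec → Set where
  ε   : Pointwise P ε ε
  _∷_ : ∀ {l M M' R R'} → P M M' → Pointwise P R R' → Pointwise P (l ≔ M , R) (l ≔ M' , R')

merge-Pointwise : ∀ {P R R' S S'} → Pointwise P R R' → Pointwise P S S' →
                  Pointwise P (merge R S) (merge R' S')
merge-Pointwise ε s = s
merge-Pointwise {P} {l ≔ M , R} {l ≔ M' , R'} (p ∷ r) = go
  where
  go : ∀ {S S'} → Pointwise P S S' → Pointwise P (merge (l ≔ M , R) S) (merge (l ≔ M' , R') S')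
  go ε = p ∷ r
  go (_∷_ {l = k} q s) with <-cmp l k
  ... | tri< _ _ _ = p ∷ merge-Pointwise r (q ∷ s)
  ... | tri≈ _ _ _ = q ∷ merge-Pointwise r s
  ... | tri> _ _ _ = q ∷ go s

lookup-Pointwise : ∀ {P R R' l M} → Pointwise P R R' → lookup R l ≡ just M →
                   ∃ λ M' → lookup R' l ≡ just M' × P M M'
lookup-Pointwise ε ()
lookup-Pointwise {l = l} (_∷_ {l = k} p r) eq with <-cmp k l
lookup-Pointwise (p ∷ r) eq   | tri< _ _ _ = lookup-Pointwise r eq
lookup-Pointwise (p ∷ r) refl | tri≈ _ _ _ = _ , refl , p
lookup-Pointwise (p ∷ r) eq   | tri> _ _ _ = lookup-Pointwise r eq

Graph : (Term → Term) → Term → Term → Set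
Graph f M N = N ≡ f M

Pointwise-Graph-functional : ∀ {f R S T} → Pointwise (Graph f) R S → Pointwise (Graph f) R T → S ≡ T
Pointwise-Graph-functional ε ε = refl
Pointwise-Graph-functional {R = l ≔ _ , _} (refl ∷ s) (refl ∷ t) =
  cong (l ≔ _ ,_) (Pointwise-Graph-functional s t)

module Fieldwise {f : Term → Term} {g : Rec → Rec}
                 (g-fieldwise : ∀ R → Pointwise (Graph f) R (g R)) where

  merge-commute : ∀ R S → g (merge R S) ≡ merge (g R) (g S)
  merge-commute R S = Pointwise-Graph-functional (g-fieldwise (merge R S))
                                                 (merge-Pointwise (g-fieldwise R) (g-fieldwise S))

  lookup-commute : ∀ {R l M} → lookup R l ≡ just M → lookup (g R) l ≡ just (f M)
  lookup-commute {R} eq with lookup-Pointwise (g-fieldwise R) eq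
  ... | _ , eq' , refl = eq'

renameRec-fieldwise : ∀ ρ R → Pointwise (Graph (rename ρ)) R (renameRec ρ R)
renameRec-fieldwise ρ ε           = ε
renameRec-fieldwise ρ (l ≔ M , R) = refl ∷ renameRec-fieldwise ρ R

substRec-fieldwise : ∀ σ R → Pointwise (Graph (subst σ)) R (substRec σ R)
substRec-fieldwise σ ε           = ε
substRec-fieldwise σ (l ≔ M , R) = refl ∷ substRec-fieldwise σ R

module RenameRec ρ = Fieldwise (renameRec-fieldwise ρ)
module SubstRec σ = Fieldwise (substRec-fieldwise σ)

infix 4 _⇛_ _⇛ᴿ_

data _⇛_ : Term → Term → Set where
  var  : ∀ {x} → var x ⇛ var x
  lam  : ∀ {M M'} → M ⇛ M' → lam M ⇛ lam M'
  app  : ∀ {M M' N N'} → M ⇛ M' → N ⇛ N' → app M N ⇛ app M' N'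
  β    : ∀ {M M' N N'} → M ⇛ M' → N ⇛ N' → app (lam M) N ⇛ M' [ N' ]
  sel  : ∀ {M M' l} → M ⇛ M' → sel M l ⇛ sel M' l
  selβ : ∀ {R R' l M} → Pointwise _⇛_ R R' → lookup R' l ≡ just M → sel (rec R) l ⇛ M
  rec  : ∀ {R R'} → Pointwise _⇛_ R R' → rec R ⇛ rec R'
  _⊕_  : ∀ {M M' R R'} → M ⇛ M' → Pointwise _⇛_ R R' → M ⊕ R ⇛ M' ⊕ R'
  ⊕β   : ∀ {R R' S S'} → Pointwise _⇛_ R R' → Pointwise _⇛_ S S' → rec R ⊕ S ⇛ rec (merge R' S')

_⇛ᴿ_ : Rec → Rec → Set
_⇛ᴿ_ = Pointwise _⇛_

⇛-refl  : ∀ M → M ⇛ M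
⇛ᴿ-refl : ∀ R → R ⇛ᴿ R
⇛-refl (var x)   = var
⇛-refl (lam M)   = lam (⇛-refl M)
⇛-refl (app M N) = app (⇛-refl M) (⇛-refl N)
⇛-refl (sel M l) = sel (⇛-refl M)
⇛-refl (rec R)   = rec (⇛ᴿ-refl R)
⇛-refl (M ⊕ R)   = ⇛-refl M ⊕ ⇛ᴿ-refl R
⇛ᴿ-refl ε           = ε
⇛ᴿ-refl (l ≔ M , R) = ⇛-refl M ∷ ⇛ᴿ-refl R

⇛-rename  : ∀ ρ {M M'} → M ⇛ M' → rename ρ M ⇛ rename ρ M'
⇛ᴿ-rename : ∀ ρ {R R'} → R ⇛ᴿ R' → renameRec ρ R ⇛ᴿ renameRec ρ R'
⇛-rename ρ var        = var
⇛-rename ρ (lam p)    = lam (⇛-rename (ext ρ) p)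
⇛-rename ρ (app p q)  = app (⇛-rename ρ p) (⇛-rename ρ q)
⇛-rename ρ (β {M' = M'} {N' = N'} p q) =
  transport (_ ⇛_) (sym (rename-[] ρ M' N')) (β (⇛-rename (ext ρ) p) (⇛-rename ρ q))
⇛-rename ρ (sel p)    = sel (⇛-rename ρ p)
⇛-rename ρ (selβ {R' = R'} r eq) = selβ (⇛ᴿ-rename ρ r) (RenameRec.lookup-commute ρ {R'} eq)
⇛-rename ρ (rec r)    = rec (⇛ᴿ-rename ρ r)
⇛-rename ρ (p ⊕ r)    = ⇛-rename ρ p ⊕ ⇛ᴿ-rename ρ r
⇛-rename ρ (⊕β {R' = R'} {S' = S'} r s) =
  transport (λ T → _ ⇛ rec T) (sym (RenameRec.merge-commute ρ R' S')) (⊕β (⇛ᴿ-rename ρ r) (⇛ᴿ-rename ρ s))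
⇛ᴿ-rename ρ ε       = ε
⇛ᴿ-rename ρ (p ∷ r) = ⇛-rename ρ p ∷ ⇛ᴿ-rename ρ r

⇛-exts : ∀ {σ τ} → (∀ x → σ x ⇛ τ x) → ∀ x → exts σ x ⇛ exts τ x
⇛-exts h zero    = var
⇛-exts h (suc x) = ⇛-rename suc (h x)

⇛-subst  : ∀ {σ τ} → (∀ x → σ x ⇛ τ x) → ∀ {M M'} → M ⇛ M' → subst σ M ⇛ subst τ M'
⇛ᴿ-subst : ∀ {σ τ} → (∀ x → σ x ⇛ τ x) → ∀ {R R'} → R ⇛ᴿ R' → substRec σ R ⇛ᴿ substRec τ R'
⇛-subst h (var {x}) = h x
⇛-subst h (lam p)   = lam (⇛-subst (⇛-exts h) p)
⇛-subst h (app p q) = app (⇛-subst h p) (⇛-subst h q)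
⇛-subst {τ = τ} h (β {M' = M'} {N' = N'} p q) =
  transport (_ ⇛_) (sym (subst-[] τ M' N')) (β (⇛-subst (⇛-exts h) p) (⇛-subst h q))
⇛-subst h (sel p)   = sel (⇛-subst h p)
⇛-subst {τ = τ} h (selβ {R' = R'} r eq) = selβ (⇛ᴿ-subst h r) (SubstRec.lookup-commute τ {R'} eq)
⇛-subst h (rec r)   = rec (⇛ᴿ-subst h r)
⇛-subst h (p ⊕ r)   = ⇛-subst h p ⊕ ⇛ᴿ-subst h r
⇛-subst {τ = τ} h (⊕β {R' = R'} {S' = S'} r s) =
  transport (λ T → _ ⇛ rec T) (sym (SubstRec.merge-commute τ R' S')) (⊕β (⇛ᴿ-subst h r) (⇛ᴿ-subst h s))
⇛ᴿ-subst h ε       = ε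
⇛ᴿ-subst h (p ∷ r) = ⇛-subst h p ∷ ⇛ᴿ-subst h r

⇛-[] : ∀ {M M' N N'} → M ⇛ M' → N ⇛ N' → M [ N ] ⇛ M' [ N' ]
⇛-[] p q = ⇛-subst (λ { zero → q ; (suc x) → var }) p

selectOr : Maybe Term → Rec → Label → Term
selectOr (just M) R l = M
selectOr nothing  R l = sel (rec R) l

develop    : Term → Term
developRec : Rec → Rec
develop (var x)             = var x
develop (lam M)             = lam (develop M)
develop (app (lam M) N)     = develop M [ develop N ]
develop (app M N)           = app (develop M) (develop N)
develop (sel (rec R) l)     = selectOr (lookup (developRec R) l) (developRec R) l
develop (sel M l)           = sel (develop M) l
develop (rec R)             = rec (developRec R)
develop (rec R ⊕ S)         = rec (merge (developRec R) (developRec S))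
develop (M ⊕ S)             = develop M ⊕ developRec S
developRec ε           = ε
developRec (l ≔ M , R) = l ≔ develop M , developRec R

⇛-selectOr : ∀ {R R' l} → R ⇛ᴿ R' → sel (rec R) l ⇛ selectOr (lookup R' l) R' l
⇛-selectOr {R' = R'} {l} r with lookup R' l in eq
... | just M  = selβ r eq
... | nothing = sel (rec r)

-- The non-redex cases are spelled out so that develop unfolds on each head.
triangle    : ∀ {M M'} → M ⇛ M' → M' ⇛ develop M
triangleRec : ∀ {R R'} → R ⇛ᴿ R' → R' ⇛ᴿ developRec R
triangle var                    = var
triangle (lam p)                = lam (triangle p)
triangle (app (lam p) q)        = β (triangle p) (triangle q)
triangle (app p@var q)          = app (triangle p) (triangle q)
triangle (app p@(app _ _) q)    = app (triangle p) (triangle q)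
triangle (app p@(β _ _) q)      = app (triangle p) (triangle q)
triangle (app p@(sel _) q)      = app (triangle p) (triangle q)
triangle (app p@(selβ _ _) q)   = app (triangle p) (triangle q)
triangle (app p@(rec _) q)      = app (triangle p) (triangle q)
triangle (app p@(_ ⊕ _) q)      = app (triangle p) (triangle q)
triangle (app p@(⊕β _ _) q)     = app (triangle p) (triangle q)
triangle (β p q)                = ⇛-[] (triangle p) (triangle q)
triangle (sel (rec r))          = ⇛-selectOr (triangleRec r)
triangle (sel p@var)            = sel (triangle p)
triangle (sel p@(lam _))        = sel (triangle p)
triangle (sel p@(app _ _))      = sel (triangle p)
triangle (sel p@(β _ _))        = sel (triangle p)
triangle (sel p@(sel _))        = sel (triangle p)
triangle (sel p@(selβ _ _))     = sel (triangle p)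
triangle (sel p@(_ ⊕ _))        = sel (triangle p)
triangle (sel p@(⊕β _ _))       = sel (triangle p)
triangle (selβ r eq) with lookup-Pointwise (triangleRec r) eq
... | _ , eq' , q rewrite eq'   = q
triangle (rec r)                = rec (triangleRec r)
triangle (rec r ⊕ s)            = ⊕β (triangleRec r) (triangleRec s)
triangle (p@var ⊕ s)            = triangle p ⊕ triangleRec s
triangle (p@(lam _) ⊕ s)        = triangle p ⊕ triangleRec s
triangle (p@(app _ _) ⊕ s)      = triangle p ⊕ triangleRec s
triangle (p@(β _ _) ⊕ s)        = triangle p ⊕ triangleRec s
triangle (p@(sel _) ⊕ s)        = triangle p ⊕ triangleRec s
triangle (p@(selβ _ _) ⊕ s)     = triangle p ⊕ triangleRec s
triangle (p@(_ ⊕ _) ⊕ s)        = triangle p ⊕ triangleRec s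
triangle (p@(⊕β _ _) ⊕ s)       = triangle p ⊕ triangleRec s
triangle (⊕β r s)               = rec (merge-Pointwise (triangleRec r) (triangleRec s))
triangleRec ε       = ε
triangleRec (p ∷ r) = triangle p ∷ triangleRec r

⟶⇒⇛   : ∀ {M M'} → M ⟶ M' → M ⇛ M'
⟶ᴿ⇒⇛ᴿ : ∀ {R R'} → R ⟶ᴿ R' → R ⇛ᴿ R'
⟶⇒⇛ {app (lam M) N} β      = β (⇛-refl M) (⇛-refl N)
⟶⇒⇛ {sel (rec R) l} (sel eq) = selβ (⇛ᴿ-refl R) eq
⟶⇒⇛ {rec R ⊕ S} merge⊕     = ⊕β (⇛ᴿ-refl R) (⇛ᴿ-refl S)
⟶⇒⇛ (ξlam s)               = lam (⟶⇒⇛ s)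
⟶⇒⇛ {app _ N} (ξappˡ s)    = app (⟶⇒⇛ s) (⇛-refl N)
⟶⇒⇛ {app M _} (ξappʳ s)    = app (⇛-refl M) (⟶⇒⇛ s)
⟶⇒⇛ (ξsel s)               = sel (⟶⇒⇛ s)
⟶⇒⇛ (ξrec s)               = rec (⟶ᴿ⇒⇛ᴿ s)
⟶⇒⇛ {_ ⊕ R} (ξ⊕ˡ s)        = ⟶⇒⇛ s ⊕ ⇛ᴿ-refl R
⟶⇒⇛ {M ⊕ _} (ξ⊕ʳ s)        = ⇛-refl M ⊕ ⟶ᴿ⇒⇛ᴿ s
⟶ᴿ⇒⇛ᴿ {_ ≔ _ , R} (here s)  = ⟶⇒⇛ s ∷ ⇛ᴿ-refl R
⟶ᴿ⇒⇛ᴿ {_ ≔ M , _} (there s) = ⇛-refl M ∷ ⟶ᴿ⇒⇛ᴿ s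

⇛⇒⟶*   : ∀ {M M'} → M ⇛ M' → M ⟶* M'
⇛ᴿ⇒⟶ᴿ* : ∀ {R R'} → R ⇛ᴿ R' → Star _⟶ᴿ_ R R'
⇛⇒⟶* var = ε
⇛⇒⟶* (lam p) = gmap lam ξlam (⇛⇒⟶* p)
⇛⇒⟶* (app {M' = M'} {N = N} p q) =
  gmap (λ X → app X N) ξappˡ (⇛⇒⟶* p) ◅◅ gmap (app M') ξappʳ (⇛⇒⟶* q)
⇛⇒⟶* (β {M' = M'} {N = N} p q) =
  gmap (λ X → app (lam X) N) (λ s → ξappˡ (ξlam s)) (⇛⇒⟶* p) ◅◅
  gmap (app (lam M')) ξappʳ (⇛⇒⟶* q) ◅◅ return β
⇛⇒⟶* (sel {l = l} p) = gmap (λ X → sel X l) ξsel (⇛⇒⟶* p)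
⇛⇒⟶* (selβ {l = l} r eq) =
  gmap (λ X → sel (rec X) l) (λ s → ξsel (ξrec s)) (⇛ᴿ⇒⟶ᴿ* r) ◅◅ return (sel eq)
⇛⇒⟶* (rec r) = gmap rec ξrec (⇛ᴿ⇒⟶ᴿ* r)
⇛⇒⟶* (_⊕_ {M' = M'} {R = R} p r) =
  gmap (_⊕ R) ξ⊕ˡ (⇛⇒⟶* p) ◅◅ gmap (M' ⊕_) ξ⊕ʳ (⇛ᴿ⇒⟶ᴿ* r)
⇛⇒⟶* (⊕β {R' = R'} {S = S} r s) =
  gmap (λ X → rec X ⊕ S) (λ t → ξ⊕ˡ (ξrec t)) (⇛ᴿ⇒⟶ᴿ* r) ◅◅
  gmap (rec R' ⊕_) ξ⊕ʳ (⇛ᴿ⇒⟶ᴿ* s) ◅◅ return merge⊕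
⇛ᴿ⇒⟶ᴿ* ε = ε
⇛ᴿ⇒⟶ᴿ* (_∷_ {l = l} {M' = M'} {R = R} p r) =
  gmap (λ X → l ≔ X , R) here (⇛⇒⟶* p) ◅◅ gmap (l ≔ M' ,_) there (⇛ᴿ⇒⟶ᴿ* r)

⟶-confluent : Confluent _⟶_
⟶-confluent = sandwich⇒confluent ⟶⇒⇛ ⇛⇒⟶* (triangle⇒confluent develop triangle)

theorem3p2 : (M M₁ M₂ : Term) → WF M → M ⟶* M₁ → M ⟶* M₂ →
    Σ Term (λ M₃ → (M₁ ⟶* M₃) × (M₂ ⟶* M₃))
theorem3p2 _ _ _ _ = ⟶-confluent
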